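{- Let $\mathcal{S}$ be a finite transition system and $(\varphi_A,\varphi_G)$ a pair of well-formed PLDL formulas. Then $\langle\varphi_A\rangle\,\mathcal{S}\,\langle\varphi_G\rangle$ does not hold if and only if there is a variable valuation $\alpha$ such that for every variable valuation $\beta$ there is an infinite path $\pi_\beta$ through $\mathcal{S}$ starting in the initial state with $(\mathrm{tr}(\pi_\beta),\alpha)\models\varphi_A$ but $(\mathrm{tr}(\pi_\beta),\beta)\not\models\varphi_G$.
   Context: PLDL: over a finite set $P$ of propositions and variables $\mathcal{V}$, formulas $\varphi ::= p \mid \neg p \mid \varphi\wedge\varphi \mid \varphi\vee\varphi \mid \langle r\rangle\varphi \mid [r]\varphi \mid \langle r\rangle_{\le z}\varphi \mid [r]_{\le z}\varphi$, regular expressions $r ::= \phi \mid \varphi? \mid r+r \mid r\,;r \mid r^*$ ($\phi$ propositional over $P$). For $w\in(2^P)^\omega$, position $n$, valuation $\alpha:\mathcal{V}\to\mathbb{N}$: literals evaluated at $w_n$; $\langle r\rangle\varphi$ iff some $j\in\mathbb{N}$ has $(n,n+j)\in\mathcal{R}(r,w,\alpha)$ and $\varphi$ holds at $n+j$; $[r]\varphi$ iff all such $j$ have $\varphi$ at $n+j$; $\langle r\rangle_{\le z}$, $[r]_{\le z}$ likewise with $j\le\alpha(z)$. $\mathcal{R}(\phi)=\{(n,n+1)\mid w_n\models\phi\}$, $\mathcal{R}(\theta?)=\{(n,n)\mid\theta\text{ holds at }n\}$, $+$ union, $;$ composition, $^*$ reflexive-transitive closure; $(w,\alpha)\models\varphi$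 is satisfaction at position 0. Well-formed: no variable bounds both a diamond- and a box-operator. A transition system $\mathcal{S}=(S,s_0,E,\ell)$, $\ell:S\to2^P$; trace $\mathrm{tr}(v_0v_1\cdots)=\ell(v_0)\ell(v_1)\cdots$; $\mathcal{S}$ is a model of $\varphi$ w.r.t. $\alpha$ if every infinite path from $s_0$ has a trace satisfying $\varphi$ w.r.t. $\alpha$. Parallel composition $\mathcal{S}\parallel\mathcal{S}'$ (for $\ell(s_0)=\ell'(s_0')$): states $\{(s,s')\mid\ell(s)=\ell'(s')\}$, initial $(s_0,s_0')$, edges componentwise, label $\ell(s)$. $\langle\varphi_A\rangle\,\mathcal{S}\,\langle\varphi_G\rangle$ holds iff for every countably infinite (or finite) transition system $\mathcal{S}'$: if $\mathcal{S}\parallel\mathcal{S}'$ is a model of $\varphi_A$ w.r.t. some $\alpha$, then it is a model of $\varphi_G$ w.r.t. some $\beta$. -}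

module Defs where

open import Data.Nat using (ℕ; zero; suc; _+_; _≤_)
open import Data.Fin using (Fin)
open import Data.Fin.Subset using (Subset; _∈_; _∉_)
open import Data.List using (List; []; _∷_; _++_)
open import Data.List.Membership.Propositional using () renaming (_∈_ to _∈ₗ_; _∉_ to _∉ₗ_)
open import Data.Product using (Σ; _×_; _,_; proj₁; proj₂)
open import Data.Sum using (_⊎_)
open import Data.Unit using (⊤)
open import Relation.Nullary using (¬_)
open import Relation.Binary.PropositionalEquality using (_≡_)
open import Relation.Binary.Construct.Closure.ReflexiveTransitive using (Star)
open import Function.Definitions using (Injective)

-- The finite proposition set P is Fin p; a letter of 2^P is a subset.
Letter : ℕ → Set
Letter p = Subset p

Word : ℕ → Set
Word p = ℕ → Letter p

Var : Set
Var = ℕ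

Valuation : Set
Valuation = Var → ℕ

data PropF (p : ℕ) : Set where
  ptrue  : PropF p
  patom  : Fin p → PropF p
  pnot   : PropF p → PropF p
  pand   : PropF p → PropF p → PropF p
  por    : PropF p → PropF p → PropF p

⟦_⟧P : ∀ {p} → PropF p → Letter p → Set
⟦ ptrue ⟧P a = ⊤
⟦ patom i ⟧P a = i ∈ a
⟦ pnot ϕ ⟧P a = ¬ ⟦ ϕ ⟧P a
⟦ pand ϕ ψ ⟧P a = ⟦ ϕ ⟧P a × ⟦ ψ ⟧P a
⟦ por ϕ ψ ⟧P a = ⟦ ϕ ⟧P a ⊎ ⟦ ψ ⟧P a

data Form (p : ℕ) : Set
data Reg (p : ℕ) : Set

data Form p where
  lit   : Fin p → Form p
  nlit  : Fin p → Form p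
  and   : Form p → Form p → Form p
  or    : Form p → Form p → Form p
  dia   : Reg p → Form p → Form p
  box   : Reg p → Form p → Form p
  diaB  : Reg p → Var → Form p → Form p
  boxB  : Reg p → Var → Form p → Form p

data Reg p where
  step  : PropF p → Reg p
  test  : Form p → Reg p
  plusR : Reg p → Reg p → Reg p
  seqR  : Reg p → Reg p → Reg p
  starR : Reg p → Reg p

RelR : ∀ {p} → Word p → Valuation → Reg p → ℕ → ℕ → Set
Sat  : ∀ {p} → Word p → Valuation → ℕ → Form p → Set

RelR w α (step ϕ) m k = k ≡ suc m × ⟦ ϕ ⟧P (w m)
RelR w α (test θ) m k = k ≡ m × Sat w α m θ
RelR w α (plusR r s) m k = RelR w α r m k ⊎ RelR w α s m k
RelR w α (seqR r s) m k = Σ ℕ λ l → RelR w α r m l × RelR w α s l k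
RelR w α (starR r) = Star (RelR w α r)

Sat w α n (lit i) = i ∈ w n
Sat w α n (nlit i) = i ∉ w n
Sat w α n (and φ ψ) = Sat w α n φ × Sat w α n ψ
Sat w α n (or φ ψ) = Sat w α n φ ⊎ Sat w α n ψ
Sat w α n (dia r φ) = Σ ℕ λ j → RelR w α r n (n + j) × Sat w α (n + j) φ
Sat w α n (box r φ) = ∀ j → RelR w α r n (n + j) → Sat w α (n + j) φ
Sat w α n (diaB r z φ) =
  Σ ℕ λ j → j ≤ α z × RelR w α r n (n + j) × Sat w α (n + j) φ
Sat w α n (boxB r z φ) =
  ∀ j → j ≤ α z → RelR w α r n (n + j) → Sat w α (n + j) φ

_,_⊨_ : ∀ {p} → Word p → Valuation → Form p → Set
w , α ⊨ φ = Sat w α 0 φ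

diaVars : ∀ {p} → Form p → List Var
boxVars : ∀ {p} → Form p → List Var
diaVarsR : ∀ {p} → Reg p → List Var
boxVarsR : ∀ {p} → Reg p → List Var

diaVars (lit i) = []
diaVars (nlit i) = []
diaVars (and φ ψ) = diaVars φ ++ diaVars ψ
diaVars (or φ ψ) = diaVars φ ++ diaVars ψ
diaVars (dia r φ) = diaVarsR r ++ diaVars φ
diaVars (box r φ) = diaVarsR r ++ diaVars φ
diaVars (diaB r z φ) = z ∷ (diaVarsR r ++ diaVars φ)
diaVars (boxB r z φ) = diaVarsR r ++ diaVars φ

boxVars (lit i) = []
boxVars (nlit i) = []
boxVars (and φ ψ) = boxVars φ ++ boxVars ψ
boxVars (or φ ψ) = boxVars φ ++ boxVars ψ
boxVars (dia r φ) = boxVarsR r ++ boxVars φ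
boxVars (box r φ) = boxVarsR r ++ boxVars φ
boxVars (diaB r z φ) = boxVarsR r ++ boxVars φ
boxVars (boxB r z φ) = z ∷ (boxVarsR r ++ boxVars φ)

diaVarsR (step ϕ) = []
diaVarsR (test θ) = diaVars θ
diaVarsR (plusR r s) = diaVarsR r ++ diaVarsR s
diaVarsR (seqR r s) = diaVarsR r ++ diaVarsR s
diaVarsR (starR r) = diaVarsR r

boxVarsR (step ϕ) = []
boxVarsR (test θ) = boxVars θ
boxVarsR (plusR r s) = boxVarsR r ++ boxVarsR s
boxVarsR (seqR r s) = boxVarsR r ++ boxVarsR s
boxVarsR (starR r) = boxVarsR r

WellFormed : ∀ {p} → Form p → Set
WellFormed φ = ∀ z → z ∈ₗ diaVars φ → z ∉ₗ boxVars φ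

record TS (p : ℕ) (St : Set) : Set₁ where
  field
    init  : St
    Edge  : St → St → Set
    label : St → Letter p
open TS public

IsPath : ∀ {p St} → TS p St → (ℕ → St) → Set
IsPath S π = π 0 ≡ init S × (∀ i → Edge S (π i) (π (suc i)))

tr : ∀ {p St} → TS p St → (ℕ → St) → Word p
tr S π i = label S (π i)

Model : ∀ {p St} → TS p St → Form p → Valuation → Set
Model S φ α = ∀ π → IsPath S π → tr S π , α ⊨ φ

Countable : Set → Set
Countable A = Σ (A → ℕ) λ f → Injective _≡_ _≡_ f

ParSt : ∀ {p St St'} → TS p St → TS p St' → Set
ParSt {St = St} {St'} S S' =
  Σ (St × St') λ ss → label S (proj₁ ss) ≡ label S' (proj₂ ss)

_∥_⟨_⟩ : ∀ {p St St'} (S : TS p St) (S' : TS p St') →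
         label S (init S) ≡ label S' (init S') → TS p (ParSt S S')
S ∥ S' ⟨ eq ⟩ = record
  { init  = (init S , init S') , eq
  ; Edge  = λ x y → Edge S (proj₁ (proj₁ x)) (proj₁ (proj₁ y))
                  × Edge S' (proj₂ (proj₁ x)) (proj₂ (proj₁ y))
  ; label = λ x → label S (proj₁ (proj₁ x))
  }

AG : ∀ {p St} → Form p → TS p St → Form p → Set₁
AG {p} φA S φG =
  ∀ (St' : Set) → Countable St' → (S' : TS p St') →
  (eq : label S (init S) ≡ label S' (init S')) →
  (Σ Valuation λ α → Model (S ∥ S' ⟨ eq ⟩) φA α) →
  Σ Valuation λ β → Model (S ∥ S' ⟨ eq ⟩) φG β

-- If the assume-guarantee property fails, classically some environment S' makes φA hold for a
-- fixed α while φG fails for every β; projecting the refuting paths of S ∥ S' onto S gives the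
-- paths π_β.  Conversely, given the paths π_β, let S' be the countable "fan" that first branches
-- into infinitely many copies of S and then replays one of the π_β in each copy.  Every path of
-- S ∥ S' has the trace of some π_β, so S ∥ S' is a model of φA w.r.t. α, and the guarantee would
-- give some β.  Since φG only reads the finitely many variables below its variable bound, β is
-- determined for φG by a single natural number c, and the copy of S replaying π_(decode c)
-- refutes the guarantee.
module Submission where

open import Defs
open import Level using (0ℓ; lift; lower) renaming (suc to lsuc)
open import Data.Nat using (ℕ; zero; suc; _+_; _⊔_; _<_; _≤_; s≤s)
open import Data.Nat.Properties using (m≤m⊔n; m≤n⊔m; ≤-trans; +-suc; +-identityʳ)
open import Data.Fin using (Fin)
open import Data.Fin.Subset using () renaming (_∈_ to _∈ₛ_)
open import Data.Product using (Σ; _×_; _,_; proj₁; proj₂; map₂)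
import Data.Product as Product
import Data.Sum as Sum
open import Function using (_∘_)
open import Relation.Nullary using (¬_)
open import Relation.Nullary.Decidable using (map′)
open import Relation.Binary.PropositionalEquality
import Relation.Binary.Construct.Closure.ReflexiveTransitive as Star
open import Function.Bundles using (_⇔_; mk⇔)
open import Axiom.ExcludedMiddle using (ExcludedMiddle)
open import Axiom.DoubleNegationElimination using (DoubleNegationElimination; em⇒dne)

varBound : ∀ {p} → Form p → ℕ
varBoundR : ∀ {p} → Reg p → ℕ

varBound (lit i) = 0
varBound (nlit i) = 0
varBound (and φ ψ) = varBound φ ⊔ varBound ψ
varBound (or φ ψ) = varBound φ ⊔ varBound ψ
varBound (dia r φ) = varBoundR r ⊔ varBound φ
varBound (box r φ) = varBoundR r ⊔ varBound φ
varBound (diaB r z φ) = suc z ⊔ (varBoundR r ⊔ varBound φ)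
varBound (boxB r z φ) = suc z ⊔ (varBoundR r ⊔ varBound φ)

varBoundR (step ϕ) = 0
varBoundR (test θ) = varBound θ
varBoundR (plusR r s) = varBoundR r ⊔ varBoundR s
varBoundR (seqR r s) = varBoundR r ⊔ varBoundR s
varBoundR (starR r) = varBoundR r

AgreeBelow : ℕ → Valuation → Valuation → Set
AgreeBelow N β β' = ∀ {z} → z < N → β z ≡ β' z

module _ {β β' : Valuation} where

  agreeBelow-⊔ˡ : ∀ {m n} → AgreeBelow (m ⊔ n) β β' → AgreeBelow m β β'
  agreeBelow-⊔ˡ {m} {n} agree z<m = agree (≤-trans z<m (m≤m⊔n m n))

  agreeBelow-⊔ʳ : ∀ {m n} → AgreeBelow (m ⊔ n) β β' → AgreeBelow n β β'
  agreeBelow-⊔ʳ {m} {n} agree z<n = agree (≤-trans z<n (m≤n⊔m m n))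

  agreeBelow-sym : ∀ {N} → AgreeBelow N β β' → AgreeBelow N β' β
  agreeBelow-sym agree z<N = sym (agree z<N)

  agreeBelow-bounded : ∀ {p} (r : Reg p) z (φ : Form p) →
                       AgreeBelow (varBound (diaB r z φ)) β β' →
                       β z ≡ β' z × AgreeBelow (varBoundR r) β β' × AgreeBelow (varBound φ) β β'
  agreeBelow-bounded r z φ agree =
    agree (m≤m⊔n (suc z) (varBoundR r ⊔ varBound φ)) , agreeBelow-⊔ˡ rest , agreeBelow-⊔ʳ rest
    where
    rest : AgreeBelow (varBoundR r ⊔ varBound φ) β β'
    rest = agreeBelow-⊔ʳ {suc z} agree

Sat-cong : ∀ {p} (φ : Form p) {w w' : Word p} {β β' n} → w ≗ w' →
           AgreeBelow (varBound φ) β β' → Sat w β n φ → Sat w' β' n φ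
RelR-cong : ∀ {p} (r : Reg p) {w w' : Word p} {β β' m k} → w ≗ w' →
            AgreeBelow (varBoundR r) β β' → RelR w β r m k → RelR w' β' r m k

Sat-cong (lit i) {n = n} w≗w' _ = subst (i ∈ₛ_) (w≗w' n)
Sat-cong (nlit i) {n = n} w≗w' _ i∉ = i∉ ∘ subst (i ∈ₛ_) (sym (w≗w' n))
Sat-cong (and φ ψ) w≗w' agree =
  Product.map (Sat-cong φ w≗w' (agreeBelow-⊔ˡ agree)) (Sat-cong ψ w≗w' (agreeBelow-⊔ʳ agree))
Sat-cong (or φ ψ) w≗w' agree =
  Sum.map (Sat-cong φ w≗w' (agreeBelow-⊔ˡ agree)) (Sat-cong ψ w≗w' (agreeBelow-⊔ʳ agree))
Sat-cong (dia r φ) w≗w' agree =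
  map₂ (Product.map (RelR-cong r w≗w' (agreeBelow-⊔ˡ agree))
                    (Sat-cong φ w≗w' (agreeBelow-⊔ʳ agree)))
Sat-cong (box r φ) w≗w' agree always j reach =
  Sat-cong φ w≗w' (agreeBelow-⊔ʳ agree)
    (always j (RelR-cong r (sym ∘ w≗w') (agreeBelow-sym (agreeBelow-⊔ˡ agree)) reach))
Sat-cong (diaB r z φ) w≗w' agree (j , j≤ , reach , sat) =
  let z≡ , agree-r , agree-φ = agreeBelow-bounded r z φ agree in
  j , subst (j ≤_) z≡ j≤ , RelR-cong r w≗w' agree-r reach , Sat-cong φ w≗w' agree-φ sat
Sat-cong (boxB r z φ) w≗w' agree always j j≤ reach =
  let z≡ , agree-r , agree-φ = agreeBelow-bounded r z φ agree in
  Sat-cong φ w≗w' agree-φ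
    (always j (subst (j ≤_) (sym z≡) j≤) (RelR-cong r (sym ∘ w≗w') (agreeBelow-sym agree-r) reach))

RelR-cong (step ϕ) {m = m} w≗w' _ = map₂ (subst ⟦ ϕ ⟧P (w≗w' m))
RelR-cong (test θ) w≗w' agree = map₂ (Sat-cong θ w≗w' agree)
RelR-cong (plusR r s) w≗w' agree =
  Sum.map (RelR-cong r w≗w' (agreeBelow-⊔ˡ agree)) (RelR-cong s w≗w' (agreeBelow-⊔ʳ agree))
RelR-cong (seqR r s) w≗w' agree =
  map₂ (Product.map (RelR-cong r w≗w' (agreeBelow-⊔ˡ agree))
                    (RelR-cong s w≗w' (agreeBelow-⊔ʳ agree)))
RelR-cong (starR r) w≗w' agree = Star.map (RelR-cong r w≗w' agree)

-- Cantor pairing: unpair enumerates ℕ × ℕ diagonal by diagonal.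
nextOnDiagonal : ℕ × ℕ → ℕ × ℕ
nextOnDiagonal (a , zero) = 0 , suc a
nextOnDiagonal (a , suc b) = suc a , b

unpair : ℕ → ℕ × ℕ
unpair zero = 0 , 0
unpair (suc n) = nextOnDiagonal (unpair n)

triangle : ℕ → ℕ
triangle zero = 0
triangle (suc s) = triangle s + suc s

pair : ℕ × ℕ → ℕ
pair (a , b) = triangle (a + b) + a

unpair-diagonal : ∀ s a b → a + b ≡ s → unpair (triangle s + a) ≡ (a , b)
unpair-diagonal _ zero zero refl = refl
unpair-diagonal _ zero (suc b) refl = begin
  unpair (triangle b + suc b + 0)          ≡⟨ cong unpair (trans (+-identityʳ _) (+-suc (triangle b) b)) ⟩
  nextOnDiagonal (unpair (triangle b + b)) ≡⟨ cong nextOnDiagonal (unpair-diagonal b b 0 (+-identityʳ b)) ⟩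
  (0 , suc b)                              ∎
  where open ≡-Reasoning
unpair-diagonal s (suc a) b a+b≡s = begin
  unpair (triangle s + suc a)              ≡⟨ cong unpair (+-suc (triangle s) a) ⟩
  nextOnDiagonal (unpair (triangle s + a)) ≡⟨ cong nextOnDiagonal (unpair-diagonal s a (suc b) (trans (+-suc a b) a+b≡s)) ⟩
  (suc a , b)                              ∎
  where open ≡-Reasoning

unpair-pair : ∀ x → unpair (pair x) ≡ x
unpair-pair (a , b) = unpair-diagonal (a + b) a b refl

ℕ×ℕ-countable : Countable (ℕ × ℕ)
ℕ×ℕ-countable = pair , λ {x} {y} px≡py →
  trans (sym (unpair-pair x)) (trans (cong unpair px≡py) (unpair-pair y))

-- A code is read as the list of values of a valuation by repeated unpairing; encode N β stores
-- only β 0, …, β (N ∸ 1).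
decode : ℕ → Valuation
decode c zero = proj₁ (unpair c)
decode c (suc z) = decode (proj₂ (unpair c)) z

encode : ℕ → Valuation → ℕ
encode zero β = 0
encode (suc N) β = pair (β 0 , encode N (β ∘ suc))

decode-encode : ∀ N β → AgreeBelow N (decode (encode N β)) β
decode-encode (suc N) β {zero} _ = cong proj₁ (unpair-pair (β 0 , encode N (β ∘ suc)))
decode-encode (suc N) β {suc z} (s≤s z<N)
  rewrite unpair-pair (β 0 , encode N (β ∘ suc)) = decode-encode N (β ∘ suc) z<N

module _ {p St St'} (S : TS p St) (S' : TS p St') (eq : label S (init S) ≡ label S' (init S')) where

  ∥-pathˡ : ∀ ρ → IsPath (S ∥ S' ⟨ eq ⟩) ρ → IsPath S (proj₁ ∘ proj₁ ∘ ρ)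
  ∥-pathˡ _ (ρ0≡init , edges) = cong (proj₁ ∘ proj₁) ρ0≡init , proj₁ ∘ edges

  ∥-pathʳ : ∀ ρ → IsPath (S ∥ S' ⟨ eq ⟩) ρ → IsPath S' (proj₂ ∘ proj₁ ∘ ρ)
  ∥-pathʳ _ (ρ0≡init , edges) = cong (proj₂ ∘ proj₁) ρ0≡init , proj₂ ∘ edges

data FanEdge : ℕ × ℕ → ℕ × ℕ → Set where
  branch : ∀ {c c'} → FanEdge (c , 0) (c' , 1)
  follow : ∀ {c i} → FanEdge (c , suc i) (c , suc (suc i))

branch-target : ∀ {c y} → FanEdge (c , 0) y → y ≡ (proj₁ y , 1)
branch-target branch = refl

follow-target : ∀ {c i y} → FanEdge (c , suc i) y → y ≡ (c , suc (suc i))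
follow-target follow = refl

fanPath-shape : ∀ {σ : ℕ → ℕ × ℕ} → σ 0 ≡ (0 , 0) → (∀ i → FanEdge (σ i) (σ (suc i))) →
                ∀ i → σ (suc i) ≡ (proj₁ (σ 1) , suc i)
fanPath-shape {σ} σ0≡ edges zero = branch-target (subst (λ x → FanEdge x (σ 1)) σ0≡ (edges 0))
fanPath-shape {σ} σ0≡ edges (suc i) =
  follow-target (subst (λ x → FanEdge x (σ (suc (suc i)))) (fanPath-shape σ0≡ edges i) (edges (suc i)))

-- The root carries the initial label of S, so S ∥ fan is formed with refl; below the root,
-- copy c of the fan replays the labels of paths c.
module Fan {p St} (S : TS p St) (paths : ℕ → ℕ → St) (isPath : ∀ c → IsPath S (paths c)) where

  fanLabel : ℕ × ℕ → Letter p
  fanLabel (c , zero) = label S (init S)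
  fanLabel (c , suc i) = label S (paths c (suc i))

  fan : TS p (ℕ × ℕ)
  fan = record { init = 0 , 0 ; Edge = FanEdge ; label = fanLabel }

  S∥fan : TS p (ParSt S fan)
  S∥fan = S ∥ fan ⟨ refl ⟩

  S∥fan-traces-sound : ∀ ρ → IsPath S∥fan ρ → Σ ℕ λ c → tr S (paths c) ≗ tr S∥fan ρ
  S∥fan-traces-sound ρ isPathρ = c , trace≗
    where
    c = proj₁ (proj₂ (proj₁ (ρ 1)))
    fanPart = ∥-pathʳ S fan refl ρ isPathρ
    shape : ∀ i → proj₂ (proj₁ (ρ (suc i))) ≡ (c , suc i)
    shape = fanPath-shape (proj₁ fanPart) (proj₂ fanPart)
    trace≗ : tr S (paths c) ≗ tr S∥fan ρ
    trace≗ zero = cong (label S) (trans (proj₁ (isPath c)) (sym (proj₁ (∥-pathˡ S fan refl ρ isPathρ))))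
    trace≗ (suc i) = trans (cong fanLabel (sym (shape i))) (sym (proj₂ (ρ (suc i))))

  S∥fan-traces-complete : ∀ c → Σ (ℕ → ParSt S fan) λ ρ → IsPath S∥fan ρ × tr S∥fan ρ ≗ tr S (paths c)
  S∥fan-traces-complete c = ρ , (refl , edges) , trace≗
    where
    ρ : ℕ → ParSt S fan
    ρ zero = (init S , (0 , 0)) , refl
    ρ (suc i) = (paths c (suc i) , (c , suc i)) , refl
    edges : ∀ i → Edge S∥fan (ρ i) (ρ (suc i))
    edges zero = subst (λ s → Edge S s (paths c 1)) (proj₁ (isPath c)) (proj₂ (isPath c) 0) , branch
    edges (suc i) = proj₂ (isPath c) (suc i) , follow
    trace≗ : tr S∥fan ρ ≗ tr S (paths c)
    trace≗ zero = cong (label S) (sym (proj₁ (isPath c)))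
    trace≗ (suc i) = refl

RefutingPaths : ∀ {p St} → TS p St → Form p → Form p → Set
RefutingPaths {St = St} S φA φG =
  Σ Valuation λ α → ∀ β →
    Σ (ℕ → St) λ π → IsPath S π × (tr S π , α ⊨ φA) × ¬ (tr S π , β ⊨ φG)

refutingPaths⇒¬AG : ∀ {p St} (S : TS p St) (φA φG : Form p) → RefutingPaths S φA φG → ¬ AG φA S φG
refutingPaths⇒¬AG {St = St} S φA φG (α , refute) ag =
  let β , guarantee = ag (ℕ × ℕ) ℕ×ℕ-countable fan refl (α , assumption)
      c = encode (varBound φG) β
      ρ , isPathρ , ρ≗ = S∥fan-traces-complete c
  in refutes c (Sat-cong φG ρ≗ (agreeBelow-sym (decode-encode (varBound φG) β)) (guarantee ρ isPathρ))
  where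
  path : ℕ → ℕ → St
  path c = proj₁ (refute (decode c))

  path-isPath : ∀ c → IsPath S (path c)
  path-isPath c = proj₁ (proj₂ (refute (decode c)))

  satisfies : ∀ c → tr S (path c) , α ⊨ φA
  satisfies c = proj₁ (proj₂ (proj₂ (refute (decode c))))

  refutes : ∀ c → ¬ (tr S (path c) , decode c ⊨ φG)
  refutes c = proj₂ (proj₂ (proj₂ (refute (decode c))))

  open Fan S path path-isPath

  assumption : Model S∥fan φA α
  assumption ρ isPathρ =
    let c , ρ≗ = S∥fan-traces-sound ρ isPathρ in Sat-cong φA ρ≗ (λ _ → refl) (satisfies c)

module _ (em : ExcludedMiddle (lsuc 0ℓ)) where

  private
    dne : DoubleNegationElimination 0ℓ
    dne = em⇒dne (map′ lower lift em)

  ¬Model⇒refutingPath : ∀ {p St} (T : TS p St) {φ β} → ¬ Model T φ β →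
                        Σ (ℕ → St) λ π → IsPath T π × ¬ (tr T π , β ⊨ φ)
  ¬Model⇒refutingPath T ¬model =
    dne λ none → ¬model λ π isPath → dne λ ¬sat → none (π , isPath , ¬sat)

  module _ {p St} (S : TS p St) where

    ∥-refutingPaths : ∀ {φA φG St'} (S' : TS p St') (eq : label S (init S) ≡ label S' (init S')) {α} →
                      Model (S ∥ S' ⟨ eq ⟩) φA α → (∀ β → ¬ Model (S ∥ S' ⟨ eq ⟩) φG β) →
                      RefutingPaths S φA φG
    ∥-refutingPaths S' eq {α} assumption ¬guarantee = α , λ β →
      let ρ , isPathρ , ¬sat = ¬Model⇒refutingPath (S ∥ S' ⟨ eq ⟩) (¬guarantee β)
      in proj₁ ∘ proj₁ ∘ ρ , ∥-pathˡ S S' eq ρ isPathρ , assumption ρ isPathρ , ¬sat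

    ¬AG⇒refutingPaths : ∀ {φA φG} → ¬ AG φA S φG → RefutingPaths S φA φG
    ¬AG⇒refutingPaths ¬ag = dne λ none → ¬ag λ _ _ S' eq (_ , assumption) →
      dne λ ¬guarantee → none (∥-refutingPaths S' eq assumption λ β guarantee → ¬guarantee (β , guarantee))

lemma6 : ExcludedMiddle (lsuc 0ℓ) →
    ∀ {p n} (S : TS p (Fin n)) (φA φG : Form p) →
    WellFormed φA → WellFormed φG →
    (¬ AG φA S φG) ⇔
      (Σ Valuation λ α → ∀ (β : Valuation) →
        Σ (ℕ → Fin n) λ π →
          IsPath S π × (tr S π , α ⊨ φA) × ¬ (tr S π , β ⊨ φG))
lemma6 em S φA φG _ _ = mk⇔ (¬AG⇒refutingPaths em S) (refutingPaths⇒¬AG S φA φG)
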